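{- Let $G$ be a weighted graph and let $a,b$ be distinct adjacent unlooped vertices of $G$. Let $(G^{ab})'$ be the weighted graph obtained from $G^{ab}$ by changing the weights of $a$ and $b$ to $\alpha'(a)=\beta(b)$, $\beta'(a)=\alpha(b)(x-1)^{2}$, $\alpha'(b)=\beta(a)$ and $\beta'(b)=\alpha(a)(x-1)^{2}$ (all other vertices keep their weights). Then \[ (x-1)^{2}\,q(G)=q\big((G^{ab})'\big). \]
   Context: All graphs are finite and may have loops (at most one per vertex) but no multiple edges. The adjacency matrix of a graph is the symmetric $0/1$ matrix over $GF(2)$ whose diagonal entry at $v$ is $1$ iff $v$ is looped; $r(G)$ and $n(G)$ denote its rank and nullity over $GF(2)$ (the empty graph has $r=n=0$). For $S\subseteq V(G)$, $G[S]$ is the induced subgraph. Let $A$ be a commutative ring with unity containing elements $x,y$ (e.g. $A=R[x,y]$). A weighted graph is a graph $G$ together with functions $\alpha,\beta:V(G)\to A$, and its weighted interlace polynomial is \[ q(G)=\sum_{S\subseteq V(G)}\Big(\prod_{s\in S}\alpha(s)\Big)\Big(\prod_{v\notin S}\beta(v)\Big)(x-1)^{r(G[S])}(y-1)^{n(G[S])}. \] Pivot: for distinct vertices $a,b$, $G^{ab}$ is obtained from $G$ (keeping all vertex weights) by toggling the adjacency $\{u,w\}$ for every pair with $u,w\notin\{a,b\}$, $u$ adjacent to $a$, $w$ adjacent to $b$, and either $u$ not adjacent to $b$ or $w$ not adjacent to $a$ (loops are not toggled). -}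

module Defs where

open import Data.Nat using (ℕ; zero; suc; _∸_)
open import Data.Bool using (Bool; true; false; if_then_else_; _∧_; _∨_; _xor_; not)
open import Data.Fin using (Fin; zero; suc; punchIn)
open import Data.Fin.Properties using () renaming (_≟_ to _≟F_)
open import Data.Vec using (Vec; []; _∷_; lookup)
open import Data.List using (List; []; _∷_; _++_; map; length; foldr)
import Data.List as L
open import Data.Maybe using (Maybe; just; nothing)
open import Relation.Nullary using (yes; no; Dec)
open import Relation.Nullary.Decidable using (⌊_⌋)
open import Relation.Binary.PropositionalEquality using (_≡_)
open import Algebra.Bundles using (CommutativeRing)

-- Graphs on vertex set Fin n, given by their adjacency matrix over GF(2)
-- (Bool, with _xor_ as addition and _∧_ as multiplication).
-- The diagonal entry at v is true iff v is looped.

Matrix : ℕ → ℕ → Set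
Matrix m n = Fin m → Fin n → Bool

AdjMatrix : ℕ → Set
AdjMatrix n = Matrix n n

SymmetricAdj : ∀ {n} → AdjMatrix n → Set
SymmetricAdj {n} M = (u w : Fin n) → M u w ≡ M w u

firstTrue : ∀ m → (Fin m → Bool) → Maybe (Fin m)
firstTrue zero f = nothing
firstTrue (suc m) f with f zero
... | true = just zero
... | false with firstTrue m (λ i → f (suc i))
...   | just i = just (suc i)
...   | nothing = nothing

rank : ∀ m n → Matrix m n → ℕ
rank zero n M = 0
rank (suc m) zero M = 0
rank (suc m) (suc n) M with firstTrue (suc m) (λ i → M i zero)
... | nothing = rank (suc m) n (λ i j → M i (suc j))
... | just p  = suc (rank m n (λ i j →
        M (punchIn p i) (suc j) xor (M (punchIn p i) zero ∧ M p (suc j))))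

nullity : ∀ m → Matrix m m → ℕ
nullity m M = m ∸ rank m m M

Subset : ℕ → Set
Subset n = Vec Bool n

allSubsets : ∀ n → List (Subset n)
allSubsets zero = [] ∷ []
allSubsets (suc n) = map (true ∷_) (allSubsets n) ++ map (false ∷_) (allSubsets n)

members : ∀ {n} → Subset n → List (Fin n)
members [] = []
members (true ∷ S) = zero ∷ map suc (members S)
members (false ∷ S) = map suc (members S)

induced : ∀ {n} → AdjMatrix n → (S : Subset n) → AdjMatrix (length (members S))
induced M S i j = M (L.lookup (members S) i) (L.lookup (members S) j)

rankInd : ∀ {n} → AdjMatrix n → Subset n → ℕ
rankInd M S = rank (length (members S)) (length (members S)) (induced M S)

nullityInd : ∀ {n} → AdjMatrix n → Subset n → ℕ
nullityInd M S = nullity (length (members S)) (induced M S)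

outside : ∀ {n} → Fin n → Fin n → Fin n → Bool
outside a b u = not ⌊ u ≟F a ⌋ ∧ not ⌊ u ≟F b ⌋

pivotCond : ∀ {n} → AdjMatrix n → Fin n → Fin n → Fin n → Fin n → Bool
pivotCond M a b u w =
  outside a b u ∧ outside a b w ∧ M u a ∧ M w b ∧ (not (M u b) ∨ not (M w a))

pivot : ∀ {n} → AdjMatrix n → Fin n → Fin n → AdjMatrix n
pivot M a b u w =
  if ⌊ u ≟F w ⌋ then M u w
  else (M u w xor (pivotCond M a b u w ∨ pivotCond M a b w u))

module Interlace {c ℓ} (R : CommutativeRing c ℓ) where
  open CommutativeRing R using (Carrier; _+_; _*_; _-_; 0#; 1#)

  pow : Carrier → ℕ → Carrier
  pow t zero = 1#
  pow t (suc k) = t * pow t k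

  sumL : List Carrier → Carrier
  sumL = foldr _+_ 0#

  weightProd : ∀ {n} → (Fin n → Carrier) → (Fin n → Carrier) → Subset n → Carrier
  weightProd α β [] = 1#
  weightProd α β (true ∷ S) = α zero * weightProd (λ i → α (suc i)) (λ i → β (suc i)) S
  weightProd α β (false ∷ S) = β zero * weightProd (λ i → α (suc i)) (λ i → β (suc i)) S

  q : (x y : Carrier) → ∀ {n} → AdjMatrix n → (Fin n → Carrier) → (Fin n → Carrier) → Carrier
  q x y {n} M α β = sumL (map term (allSubsets n))
    where
    term : Subset n → Carrier
    term S = weightProd α β S * (pow (x - 1#) (rankInd M S) * pow (y - 1#) (nullityInd M S))

  alpha' : (x : Carrier) → ∀ {n} → (α β : Fin n → Carrier) → Fin n → Fin n → Fin n → Carrier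
  alpha' x α β a b v =
    if ⌊ v ≟F a ⌋ then β b else if ⌊ v ≟F b ⌋ then β a else α v

  beta' : (x : Carrier) → ∀ {n} → (α β : Fin n → Carrier) → Fin n → Fin n → Fin n → Carrier
  beta' x α β a b v =
    if ⌊ v ≟F a ⌋ then α b * pow (x - 1#) 2
    else if ⌊ v ≟F b ⌋ then α a * pow (x - 1#) 2 else β v

-- The subsets Z, Z ∪ {a}, Z ∪ {b}, Z ∪ {a,b} (Z avoiding a and b) contribute to q(G) and to
-- q((G^{ab})′) in matching groups of four. Nullities are compared by counting null spaces:
-- 2^{n(G[S])} is the number of x ∈ GF(2)ⁿ supported on S with (Mx)_S = 0. As M_ab = 1 and a, b
-- are unlooped, rows a and b of M determine x_b and x_a, and eliminating them turns the null space
-- of G[Z ∪ {a,b}] into that of G^{ab}[Z]: the nullities agree and the ranks differ by 2 (and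
-- symmetrically, pivoting being an involution). On Z ∪ {a} and Z ∪ {b} the null spaces of G and
-- G^{ab} correspond under a shear of one coordinate, so rank and nullity are unchanged. The new
-- weights of a and b are exactly what turns (x − 1)² times each group of four terms of q(G) into
-- the matching group of q((G^{ab})′).

module Submission where

open import Defs
open import Data.Nat using (ℕ; zero; suc; _+_; _∸_; _^_; _≤_; z≤n; s≤s)
open import Data.Nat.Properties
  using (+-0-commutativeMonoid; +-identityʳ; +-comm; +-assoc; +-∸-assoc; +-cancelʳ-≡; m≤n⇒m≤1+n; m+[n∸m]≡n)
open import Data.Nat.Logarithm using (⌊log₂_⌋; ⌊log₂[2^n]⌋≡n)
open import Data.Bool using (Bool; true; false; if_then_else_; _∧_; _∨_; _xor_; not)
open import Data.Bool.Properties
  using (xor-∧-commutativeRing; xor-same; xor-identityʳ; xor-comm; ∨-comm; ∧-zeroʳ; ⇔→≡)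
open import Data.Fin as Fin using (Fin; zero; suc; punchIn)
open import Data.Fin.Properties using (suc-injective) renaming (_≟_ to _≟F_)
open import Data.Vec using (Vec; []; _∷_; lookup; _[_]≔_; cast)
open import Data.Vec.Properties
  using (lookup∘update; lookup∘update′; []≔-idempotent; []≔-commutes; []≔-lookup; cast-is-id)
open import Data.List using (List; []; _∷_; length; map)
import Data.List as List
open import Data.List.Properties using (length-map; map-++; map-∘)
open import Data.Maybe using (just; nothing)
open import Data.Product using (_×_; _,_; proj₁; proj₂)
open import Data.Sum using (_⊎_; inj₁; inj₂; swap)
open import Data.Empty using (⊥-elim)
open import Function using (_∘_; _⇔_; mk⇔; Equivalence)
open import Relation.Nullary using (yes; no)
open import Relation.Nullary.Decidable using (⌊_⌋)
open import Relation.Binary.PropositionalEquality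
open import Algebra.Bundles using (CommutativeRing; CommutativeMonoid)
import Algebra.Solver.CommutativeMonoid
open import Tactic.RingSolver using (solve-∀)
open import Tactic.RingSolver.Core.AlmostCommutativeRing using (AlmostCommutativeRing; fromCommutativeRing)

GF2 : AlmostCommutativeRing _ _
GF2 = fromCommutativeRing xor-∧-commutativeRing λ { false → just refl ; true → nothing }

∧-≡true : ∀ {u v} → u ∧ v ≡ true ⇔ (u ≡ true × v ≡ true)
∧-≡true {true} = mk⇔ (refl ,_) proj₂
∧-≡true {false} = mk⇔ (λ ()) (λ ())

not-xor-≡true : ∀ {u v} → not (u xor v) ≡ true ⇔ u ≡ v
not-xor-≡true {true} {true} = mk⇔ (λ _ → refl) (λ _ → refl)
not-xor-≡true {true} {false} = mk⇔ (λ ()) (λ ())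
not-xor-≡true {false} {true} = mk⇔ (λ ()) (λ ())
not-xor-≡true {false} {false} = mk⇔ (λ _ → refl) (λ _ → refl)

∧-swap : ∀ u v w → u ∧ (v ∧ w) ≡ v ∧ (u ∧ w)
∧-swap = solve-∀ GF2

true≢false : true ≢ false
true≢false ()

xor-≡false : ∀ {u v} → u xor v ≡ false → u ≡ v
xor-≡false {true} {true} _ = refl
xor-≡false {false} {false} _ = refl

or-not-≡true : ∀ {u v} → u ∨ not v ≡ true ⇔ (u ≡ false → v ≡ false)
or-not-≡true {true} = mk⇔ (λ _ ()) (λ _ → refl)
or-not-≡true {false} {true} = mk⇔ (λ ()) (λ h → sym (h refl))
or-not-≡true {false} {false} = mk⇔ (λ _ _ → refl) (λ _ → refl)

not-or-not-≡true : ∀ {u v} → not u ∨ not v ≡ true ⇔ (u ≡ true → v ≡ false)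
not-or-not-≡true {false} = mk⇔ (λ _ ()) (λ _ → refl)
not-or-not-≡true {true} {true} = mk⇔ (λ ()) (λ h → sym (h refl))
not-or-not-≡true {true} {false} = mk⇔ (λ _ _ → refl) (λ _ → refl)

dot : ∀ {n} → (Fin n → Bool) → Vec Bool n → Bool
dot r [] = false
dot r (b ∷ x) = (r zero ∧ b) xor dot (r ∘ suc) x

dot-cong : ∀ {n} {r s : Fin n → Bool} (x : Vec Bool n) → (∀ j → r j ≡ s j) → dot r x ≡ dot s x
dot-cong [] eq = refl
dot-cong (b ∷ x) eq = cong₂ (λ u v → (u ∧ b) xor v) (eq zero) (dot-cong x (eq ∘ suc))

dot-cong-support : ∀ {n} {r s : Fin n → Bool} (x : Vec Bool n) →
  (∀ j → lookup x j ≡ true → r j ≡ s j) → dot r x ≡ dot s x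
dot-cong-support [] eq = refl
dot-cong-support (true ∷ x) eq =
  cong₂ (λ u v → (u ∧ true) xor v) (eq zero refl) (dot-cong-support x (eq ∘ suc))
dot-cong-support {r = r} {s} (false ∷ x) eq =
  cong₂ _xor_ (trans (∧-zeroʳ (r zero)) (sym (∧-zeroʳ (s zero)))) (dot-cong-support x (eq ∘ suc))

dot-linear : ∀ {n} (r s : Fin n → Bool) c (x : Vec Bool n) →
  dot (λ j → r j xor (c ∧ s j)) x ≡ dot r x xor (c ∧ dot s x)
dot-linear r s c [] = sym (∧-zeroʳ c)
dot-linear r s c (b ∷ x) =
  trans (cong (((r zero xor (c ∧ s zero)) ∧ b) xor_) (dot-linear (r ∘ suc) (s ∘ suc) c x))
        (distrib (r zero) (s zero) c b (dot (r ∘ suc) x) (dot (s ∘ suc) x))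
  where
  distrib : ∀ r s c b d e →
    ((r xor (c ∧ s)) ∧ b) xor (d xor (c ∧ e)) ≡ ((r ∧ b) xor d) xor (c ∧ ((s ∧ b) xor e))
  distrib = solve-∀ GF2

dot-update : ∀ {n} (r : Fin n → Bool) (x : Vec Bool n) a →
  dot r x ≡ dot r (x [ a ]≔ false) xor (r a ∧ lookup x a)
dot-update r (c ∷ x) zero = move (r zero) c (dot (r ∘ suc) x)
  where
  move : ∀ r c d → (r ∧ c) xor d ≡ ((r ∧ false) xor d) xor (r ∧ c)
  move = solve-∀ GF2
dot-update r (c ∷ x) (suc a) =
  trans (cong ((r zero ∧ c) xor_) (dot-update (r ∘ suc) x a))
        (assoc (r zero ∧ c) (dot (r ∘ suc) (x [ a ]≔ false)) (r (suc a) ∧ lookup x a))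
  where
  assoc : ∀ p q s → p xor (q xor s) ≡ (p xor q) xor s
  assoc = solve-∀ GF2

dot-update-irrelevant : ∀ {n} (r : Fin n → Bool) (x : Vec Bool n) a c → r a ≡ false →
  dot r (x [ a ]≔ c) ≡ dot r x
dot-update-irrelevant r x a c ra = begin
  dot r (x [ a ]≔ c)
    ≡⟨ dot-update r (x [ a ]≔ c) a ⟩
  dot r ((x [ a ]≔ c) [ a ]≔ false) xor (r a ∧ lookup (x [ a ]≔ c) a)
    ≡⟨ cong₂ (λ y u → dot r y xor (u ∧ lookup (x [ a ]≔ c) a)) ([]≔-idempotent x a) ra ⟩
  dot r (x [ a ]≔ false) xor false
    ≡⟨ cong (λ u → dot r (x [ a ]≔ false) xor (u ∧ lookup x a)) (sym ra) ⟩
  dot r (x [ a ]≔ false) xor (r a ∧ lookup x a)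
    ≡⟨ dot-update r x a ⟨
  dot r x ∎
  where open ≡-Reasoning

≢-by-lookup : ∀ {n} (x : Vec Bool n) {i j b₁ b₂} →
  lookup x i ≡ b₁ → lookup x j ≡ b₂ → b₁ ≢ b₂ → i ≢ j
≢-by-lookup x xi xj b₁≢b₂ refl = b₁≢b₂ (trans (sym xi) xj)

allFin : ∀ m → (Fin m → Bool) → Bool
allFin zero f = true
allFin (suc m) f = f zero ∧ allFin m (f ∘ suc)

allFin-≡true : ∀ {m} {f : Fin m → Bool} → allFin m f ≡ true ⇔ (∀ i → f i ≡ true)
allFin-≡true {zero} = mk⇔ (λ _ ()) (λ _ → refl)
allFin-≡true {suc m} {f} = mk⇔ to from
  where
  to : allFin (suc m) f ≡ true → ∀ i → f i ≡ true
  to h zero = proj₁ (Equivalence.to ∧-≡true h)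
  to h (suc i) = Equivalence.to allFin-≡true (proj₂ (Equivalence.to (∧-≡true {f zero}) h)) i
  from : (∀ i → f i ≡ true) → allFin (suc m) f ≡ true
  from h = Equivalence.from ∧-≡true (h zero , Equivalence.from allFin-≡true (h ∘ suc))

allFin-cong : ∀ m {f g : Fin m → Bool} → (∀ i → f i ≡ g i) → allFin m f ≡ allFin m g
allFin-cong zero eq = refl
allFin-cong (suc m) eq = cong₂ _∧_ (eq zero) (allFin-cong m (eq ∘ suc))

allFin-true : ∀ m → allFin m (λ _ → true) ≡ true
allFin-true zero = refl
allFin-true (suc m) = allFin-true m

allFin-punchIn : ∀ m (p : Fin (suc m)) f → allFin (suc m) f ≡ f p ∧ allFin m (f ∘ punchIn p)
allFin-punchIn m zero f = refl
allFin-punchIn (suc m) (suc p) f =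
  trans (cong (f zero ∧_) (allFin-punchIn m p (f ∘ suc))) (∧-swap (f zero) (f (suc p)) _)

-- Sums over the cube {0,1}ⁿ

assign : ∀ {n} (a b : Fin n) → Bool → Bool → Vec Bool n → Vec Bool n
assign a b s t z = (z [ b ]≔ t) [ a ]≔ s

module CubeSum {c ℓ} (M : CommutativeMonoid c ℓ) where
  open CommutativeMonoid M renaming (Carrier to C; refl to ≈-refl; sym to ≈-sym; trans to ≈-trans)
  open import Algebra.Properties.CommutativeSemigroup commutativeSemigroup using (interchange)

  ∑ : ∀ n → (Vec Bool n → C) → C
  ∑ zero f = f []
  ∑ (suc n) f = ∑ n (f ∘ (true ∷_)) ∙ ∑ n (f ∘ (false ∷_))

  ∑-cong : ∀ n {f g : Vec Bool n → C} → (∀ x → f x ≈ g x) → ∑ n f ≈ ∑ n g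
  ∑-cong zero eq = eq []
  ∑-cong (suc n) eq = ∙-cong (∑-cong n (eq ∘ (true ∷_))) (∑-cong n (eq ∘ (false ∷_)))

  ∑-distrib : ∀ n (f g : Vec Bool n → C) → ∑ n (λ x → f x ∙ g x) ≈ ∑ n f ∙ ∑ n g
  ∑-distrib zero f g = ≈-refl
  ∑-distrib (suc n) f g = ≈-trans (∙-cong (∑-distrib n _ _) (∑-distrib n _ _)) (interchange _ _ _ _)

  ∑-ε : ∀ n → ∑ n (λ _ → ε) ≈ ε
  ∑-ε zero = ≈-refl
  ∑-ε (suc n) = ≈-trans (∙-cong (∑-ε n) (∑-ε n)) (identityˡ ε)

  -- Each vector is counted once, through the representative with aᵗʰ coordinate false.
  ∑-pairUp : ∀ n a (f : Vec Bool n → C) →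
    ∑ n f ≈ ∑ n (λ x → if lookup x a then ε else f (x [ a ]≔ true) ∙ f (x [ a ]≔ false))
  ∑-pairUp (suc n) zero f = ≈-sym (≈-trans (∙-cong (∑-ε n) (∑-distrib n _ _)) (identityˡ _))
  ∑-pairUp (suc n) (suc a) f = ∙-cong (∑-pairUp n a _) (∑-pairUp n a _)

  quadrupleAt : ∀ {n} (a b : Fin n) → (Vec Bool n → C) → Vec Bool n → C
  quadrupleAt a b f z =
    if lookup z b ∨ lookup z a then ε
    else (f (assign a b true true z) ∙ f (assign a b false true z)) ∙
         (f (assign a b true false z) ∙ f (assign a b false false z))

  ∑-quadruple : ∀ n {a b} → a ≢ b → (f : Vec Bool n → C) → ∑ n f ≈ ∑ n (quadrupleAt a b f)
  ∑-quadruple n {a} {b} a≢b f = ≈-trans (∑-pairUp n a f) (≈-trans (∑-pairUp n b _) (∑-cong n quadruple))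
    where
    pairA : Vec Bool n → C
    pairA x = if lookup x a then ε else f (x [ a ]≔ true) ∙ f (x [ a ]≔ false)
    quadruple : ∀ z →
      (if lookup z b then ε else pairA (z [ b ]≔ true) ∙ pairA (z [ b ]≔ false)) ≈ quadrupleAt a b f z
    quadruple z with lookup z b
    ... | true = ≈-refl
    ... | false rewrite lookup∘update′ a≢b z true | lookup∘update′ a≢b z false with lookup z a
    ...   | true = identityˡ ε
    ...   | false = ≈-refl

open CubeSum +-0-commutativeMonoid
  using () renaming (∑ to ∑ℕ; ∑-cong to ∑ℕ-cong; ∑-distrib to ∑ℕ-distrib; ∑-pairUp to ∑ℕ-pairUp)

indicator : Bool → ℕ
indicator b = if b then 1 else 0

count : ∀ n → (Vec Bool n → Bool) → ℕ
count n P = ∑ℕ n (indicator ∘ P)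

count-cong : ∀ n {P Q : Vec Bool n → Bool} → (∀ x → P x ≡ Q x) → count n P ≡ count n Q
count-cong n eq = ∑ℕ-cong n (cong indicator ∘ eq)

count-true : ∀ n → count n (λ _ → true) ≡ 2 ^ n
count-true zero = refl
count-true (suc n) = trans (cong₂ _+_ (count-true n) (count-true n)) (cong (2 ^ n +_) (sym (+-identityʳ (2 ^ n))))

count-false : ∀ n → count n (λ _ → false) ≡ 0
count-false zero = refl
count-false (suc n) = cong₂ _+_ (count-false n) (count-false n)

count-partition : ∀ n (h P : Vec Bool n → Bool) →
  count n (λ x → h x ∧ P x) + count n (λ x → not (h x) ∧ P x) ≡ count n P
count-partition n h P = trans (sym (∑ℕ-distrib n _ _)) (∑ℕ-cong n (λ x → split (h x) (P x)))
  where
  split : ∀ h p → indicator (h ∧ p) + indicator (not h ∧ p) ≡ indicator p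
  split true true = refl
  split true false = refl
  split false p = refl

count-byFibres : ∀ n a {P Q : Vec Bool n → Bool} →
  (∀ x → indicator (P (x [ a ]≔ true)) + indicator (P (x [ a ]≔ false))
       ≡ indicator (Q (x [ a ]≔ true)) + indicator (Q (x [ a ]≔ false))) →
  count n P ≡ count n Q
count-byFibres n a fibres =
  trans (∑ℕ-pairUp n a _)
        (trans (∑ℕ-cong n (λ x → cong (if lookup x a then 0 else_) (fibres x))) (sym (∑ℕ-pairUp n a _)))

IndependentOf : ∀ {n} {A : Set} → Fin n → (Vec Bool n → A) → Set
IndependentOf a h = ∀ x c → h (x [ a ]≔ c) ≡ h x

-- On each fibre {x_a = 0, x_a = 1} the shear either fixes both points or swaps them.
count-shear : ∀ n a (g P : Vec Bool n → Bool) → IndependentOf a g →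
  count n (λ x → P (x [ a ]≔ (lookup x a xor g x))) ≡ count n P
count-shear n a g P g-indep = count-byFibres n a fibre
  where
  fibre : ∀ x →
    indicator (P ((x [ a ]≔ true) [ a ]≔ (lookup (x [ a ]≔ true) a xor g (x [ a ]≔ true))))
    + indicator (P ((x [ a ]≔ false) [ a ]≔ (lookup (x [ a ]≔ false) a xor g (x [ a ]≔ false))))
    ≡ indicator (P (x [ a ]≔ true)) + indicator (P (x [ a ]≔ false))
  fibre x rewrite lookup∘update a x true | lookup∘update a x false | g-indep x true | g-indep x false
                | []≔-idempotent {x = true} {y = not (g x)} x a
                | []≔-idempotent {x = false} {y = g x} x a with g x
  ... | true = +-comm (indicator (P (x [ a ]≔ false))) _
  ... | false = refl

count-pin : ∀ n a (h P : Vec Bool n → Bool) → IndependentOf a h → IndependentOf a P →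
  count n (λ x → not (lookup x a xor h x) ∧ P x) ≡ count n (λ x → not (lookup x a) ∧ P x)
count-pin n a h P h-indep P-indep =
  trans (count-cong n sheared) (count-shear n a h (λ y → not (lookup y a) ∧ P y) h-indep)
  where
  sheared : ∀ x → not (lookup x a xor h x) ∧ P x
                ≡ not (lookup (x [ a ]≔ (lookup x a xor h x)) a) ∧ P (x [ a ]≔ (lookup x a xor h x))
  sheared x = sym (cong₂ (λ u v → not u ∧ v) (lookup∘update a x _) (P-indep x _))

firstTrue-nothing : ∀ m (f : Fin m → Bool) → firstTrue m f ≡ nothing → ∀ i → f i ≡ false
firstTrue-nothing (suc m) f e i with f zero in f0
firstTrue-nothing (suc m) f () i | true
... | false with firstTrue m (f ∘ suc) in rest
firstTrue-nothing (suc m) f () i | false | just _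
firstTrue-nothing (suc m) f e zero | false | nothing = f0
firstTrue-nothing (suc m) f e (suc i) | false | nothing = firstTrue-nothing m (f ∘ suc) rest i

firstTrue-just : ∀ m (f : Fin m → Bool) p → firstTrue m f ≡ just p → f p ≡ true
firstTrue-just (suc m) f p e with f zero in f0
firstTrue-just (suc m) f .zero refl | true = f0
... | false with firstTrue m (f ∘ suc) in rest
firstTrue-just (suc m) f .(suc i) refl | false | just i = firstTrue-just m (f ∘ suc) i rest
firstTrue-just (suc m) f p () | false | nothing

rank≤ : ∀ m n (M : Matrix m n) → rank m n M ≤ n
rank≤ zero n M = z≤n
rank≤ (suc m) zero M = z≤n
rank≤ (suc m) (suc n) M with firstTrue (suc m) (λ i → M i zero)
... | nothing = m≤n⇒m≤1+n (rank≤ (suc m) n _)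
... | just p = s≤s (rank≤ m n _)

kernel : ∀ m n → Matrix m n → Vec Bool n → Bool
kernel m n M x = allFin m (λ i → not (dot (M i) x))

∧-congˡ-guarded : ∀ u {v w : Bool} → (u ≡ true → v ≡ w) → u ∧ v ≡ u ∧ w
∧-congˡ-guarded true eq = eq refl
∧-congˡ-guarded false eq = refl

dropColumn : ∀ {m n} → Matrix m (suc n) → Matrix m n
dropColumn M i j = M i (suc j)

eliminate : ∀ {m n} → Matrix (suc m) (suc n) → Fin (suc m) → Matrix m n
eliminate M p i j = M (punchIn p i) (suc j) xor (M (punchIn p i) zero ∧ M p (suc j))

kernel-zeroColumn : ∀ {m n} (M : Matrix m (suc n)) → (∀ i → M i zero ≡ false) →
  ∀ b x → kernel m (suc n) M (b ∷ x) ≡ kernel m n (dropColumn M) x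
kernel-zeroColumn {m} M zero-column b x =
  allFin-cong m (λ i → cong (λ u → not ((u ∧ b) xor dot (dropColumn M i) x)) (zero-column i))

kernel-eliminate : ∀ {m n} (M : Matrix (suc m) (suc n)) p → M p zero ≡ true →
  ∀ b x → kernel (suc m) (suc n) M (b ∷ x) ≡ not (b xor dot (M p ∘ suc) x) ∧ kernel m n (eliminate M p) x
kernel-eliminate {m} {n} M p Mp0 b x = begin
  kernel (suc m) (suc n) M (b ∷ x)                  ≡⟨ allFin-punchIn m p (λ i → not (dot (M i) (b ∷ x))) ⟩
  not ((M p zero ∧ b) xor d) ∧ others               ≡⟨ cong (λ u → not ((u ∧ b) xor d) ∧ others) Mp0 ⟩
  not (b xor d) ∧ others
    ≡⟨ ∧-congˡ-guarded (not (b xor d))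
         (λ b≡d → allFin-cong m (reduce (Equivalence.to not-xor-≡true b≡d))) ⟩
  not (b xor d) ∧ kernel m n (eliminate M p) x      ∎
  where
  open ≡-Reasoning
  d = dot (M p ∘ suc) x
  others = allFin m (λ i → not ((M (punchIn p i) zero ∧ b) xor dot (M (punchIn p i) ∘ suc) x))
  reduce : b ≡ d → ∀ i →
    not ((M (punchIn p i) zero ∧ b) xor dot (M (punchIn p i) ∘ suc) x) ≡ not (dot (eliminate M p i) x)
  reduce refl i = cong not (begin
    (M (punchIn p i) zero ∧ d) xor dot (M (punchIn p i) ∘ suc) x
      ≡⟨ xor-comm (M (punchIn p i) zero ∧ d) _ ⟩
    dot (M (punchIn p i) ∘ suc) x xor (M (punchIn p i) zero ∧ d)
      ≡⟨ dot-linear (M (punchIn p i) ∘ suc) (M p ∘ suc) (M (punchIn p i) zero) x ⟨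
    dot (eliminate M p i) x ∎)

not-true-xor : ∀ u → not (true xor u) ≡ u
not-true-xor true = refl
not-true-xor false = refl

-- Each elimination step either finds a zero column (a free coordinate, doubling the count)
-- or solves the pivot row for the first coordinate.
count-kernel : ∀ m n (M : Matrix m n) → count n (kernel m n M) ≡ 2 ^ (n ∸ rank m n M)
count-kernel zero n M = count-true n
count-kernel (suc m) zero M = cong indicator (allFin-true m)
count-kernel (suc m) (suc n) M with firstTrue (suc m) (λ i → M i zero) in pivot-search
... | nothing = begin
    count n (K ∘ (true ∷_)) + count n (K ∘ (false ∷_))
      ≡⟨ cong₂ _+_ (count-cong n (free true)) (count-cong n (free false)) ⟩
    count n (kernel (suc m) n M′) + count n (kernel (suc m) n M′)
      ≡⟨ cong₂ _+_ (count-kernel (suc m) n M′) (count-kernel (suc m) n M′) ⟩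
    2 ^ (n ∸ rank (suc m) n M′) + 2 ^ (n ∸ rank (suc m) n M′)
      ≡⟨ cong (2 ^ (n ∸ rank (suc m) n M′) +_) (sym (+-identityʳ _)) ⟩
    2 ^ suc (n ∸ rank (suc m) n M′)
      ≡⟨ cong (2 ^_) (sym (+-∸-assoc 1 (rank≤ (suc m) n M′))) ⟩
    2 ^ (suc n ∸ rank (suc m) n M′) ∎
  where
  open ≡-Reasoning
  K = kernel (suc m) (suc n) M
  M′ = dropColumn M
  free = kernel-zeroColumn M (firstTrue-nothing (suc m) (λ i → M i zero) pivot-search)
... | just p = begin
    count n (K ∘ (true ∷_)) + count n (K ∘ (false ∷_))
      ≡⟨ cong₂ _+_
           (count-cong n (λ x → trans (solved true x) (cong (_∧ kernel m n M′ x) (not-true-xor (d x)))))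
           (count-cong n (solved false)) ⟩
    count n (λ x → d x ∧ kernel m n M′ x) + count n (λ x → not (d x) ∧ kernel m n M′ x)
      ≡⟨ count-partition n d (kernel m n M′) ⟩
    count n (kernel m n M′)
      ≡⟨ count-kernel m n M′ ⟩
    2 ^ (n ∸ rank m n M′) ∎
  where
  open ≡-Reasoning
  K = kernel (suc m) (suc n) M
  M′ = eliminate M p
  d = dot (M p ∘ suc)
  solved = kernel-eliminate M p (firstTrue-just (suc m) (λ i → M i zero) p pivot-search)

-- Null spaces of induced subgraphs

-- The null space of G[S] is embedded in GF(2)ⁿ by extending its vectors by zero.
supportedIn : ∀ {n} → Subset n → Vec Bool n → Bool
supportedIn {n} S x = allFin n (λ j → lookup S j ∨ not (lookup x j))

annihilatedOn : ∀ {n} → AdjMatrix n → Subset n → Vec Bool n → Bool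
annihilatedOn {n} M S x = allFin n (λ i → not (lookup S i) ∨ not (dot (M i) x))

nullSpace : ∀ {n} → AdjMatrix n → Subset n → Vec Bool n → Bool
nullSpace M S x = supportedIn S x ∧ annihilatedOn M S x

nullCount : ∀ {n} → AdjMatrix n → Subset n → ℕ
nullCount {n} M S = count n (nullSpace M S)

Supported : ∀ {n} → Subset n → Vec Bool n → Set
Supported S x = ∀ j → lookup S j ≡ false → lookup x j ≡ false

Annihilated : ∀ {n} → AdjMatrix n → Subset n → Vec Bool n → Set
Annihilated M S x = ∀ i → lookup S i ≡ true → dot (M i) x ≡ false

nullSpace-≡true : ∀ {n} (M : AdjMatrix n) S x →
  nullSpace M S x ≡ true ⇔ (Supported S x × Annihilated M S x)
nullSpace-≡true {n} M S x = mk⇔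
  (λ h → let (s , k) = Equivalence.to ∧-≡true h in
     (λ j → Equivalence.to or-not-≡true (Equivalence.to (allFin-≡true {f = support}) s j)) ,
     (λ i → Equivalence.to not-or-not-≡true (Equivalence.to (allFin-≡true {f = rows}) k i)))
  (λ (s , k) → Equivalence.from ∧-≡true
     ( Equivalence.from (allFin-≡true {f = support}) (λ j → Equivalence.from or-not-≡true (s j))
     , Equivalence.from (allFin-≡true {f = rows}) (λ i → Equivalence.from not-or-not-≡true (k i))))
  where
  support rows : Fin n → Bool
  support j = lookup S j ∨ not (lookup x j)
  rows i = not (lookup S i) ∨ not (dot (M i) x)

nullSpace-≡ : ∀ {n} (M N : AdjMatrix n) S T x y →
  (Supported S x × Annihilated M S x → Supported T y × Annihilated N T y) →
  (Supported T y × Annihilated N T y → Supported S x × Annihilated M S x) →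
  nullSpace M S x ≡ nullSpace N T y
nullSpace-≡ M N S T x y to from = ⇔→≡ (mk⇔ (from-T ∘ to ∘ to-S) (from-S ∘ from ∘ to-T))
  where
  open Equivalence (nullSpace-≡true M S x) renaming (to to to-S; from to from-S)
  open Equivalence (nullSpace-≡true N T y) renaming (to to to-T; from to from-T)

nullSpace-clear : ∀ {n} (M : AdjMatrix n) (S : Subset n) j → lookup S j ≡ false → ∀ x →
  nullSpace M S x ≡ not (lookup x j) ∧ nullSpace M S (x [ j ]≔ false)
nullSpace-clear M S j Sj x with lookup x j in xj
... | false = cong (nullSpace M S) (sym (trans (cong (x [ j ]≔_) (sym xj)) ([]≔-lookup x j)))
... | true with nullSpace M S x in null
...   | false = refl
...   | true = ⊥-elim (true≢false (trans (sym xj) (proj₁ (Equivalence.to (nullSpace-≡true M S x) null) j Sj)))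

nullCount-cong : ∀ {n} {M N : AdjMatrix n} (S : Subset n) →
  (∀ u w → M u w ≡ N u w) → nullCount M S ≡ nullCount N S
nullCount-cong {n} S eq = count-cong n (λ x → cong (supportedIn S x ∧_)
  (allFin-cong n (λ i → cong (λ v → not (lookup S i) ∨ not v) (dot-cong x (eq i)))))

embed : ∀ {n} (S : Subset n) → Vec Bool (length (members S)) → Vec Bool n
embed [] [] = []
embed (true ∷ S) (b ∷ y) = b ∷ embed S (cast (length-map Fin.suc (members S)) y)
embed (false ∷ S) y = false ∷ embed S (cast (length-map Fin.suc (members S)) y)

count-cast : ∀ {k k′} (e : k′ ≡ k) (P : Vec Bool k → Bool) → count k′ (P ∘ cast e) ≡ count k P
count-cast {k} refl P = count-cong k (λ y → cong P (cast-is-id refl y))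

count-supportedIn : ∀ n (S : Subset n) (P : Vec Bool n → Bool) →
  count n (λ x → supportedIn S x ∧ P x) ≡ count (length (members S)) (P ∘ embed S)
count-supportedIn zero [] P = refl
count-supportedIn (suc n) (true ∷ S) P = cong₂ _+_ (restrict true) (restrict false)
  where
  restrict : ∀ b → count n (λ x → supportedIn S x ∧ P (b ∷ x))
                 ≡ count _ (λ y → P (b ∷ embed S (cast (length-map Fin.suc (members S)) y)))
  restrict b = trans (count-supportedIn n S (P ∘ (b ∷_)))
                     (sym (count-cast (length-map Fin.suc (members S)) (λ y → P (b ∷ embed S y))))
count-supportedIn (suc n) (false ∷ S) P =
  trans (cong₂ _+_ (count-false n) (count-supportedIn n S (P ∘ (false ∷_))))
        (sym (count-cast (length-map Fin.suc (members S)) (λ y → P (false ∷ embed S y))))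

dot-map-suc : ∀ {n} (l : List (Fin n)) (r : Fin (suc n) → Bool) y →
  dot (λ j → r (List.lookup (map Fin.suc l) j)) y
  ≡ dot (λ j → r (suc (List.lookup l j))) (cast (length-map Fin.suc l) y)
dot-map-suc [] r [] = refl
dot-map-suc (i ∷ l) r (b ∷ y) = cong ((r (suc i) ∧ b) xor_) (dot-map-suc l r y)

allFin-map-suc : ∀ {n} (l : List (Fin n)) (f : Fin (suc n) → Bool) →
  allFin (length (map Fin.suc l)) (λ i → f (List.lookup (map Fin.suc l) i))
  ≡ allFin (length l) (λ i → f (suc (List.lookup l i)))
allFin-map-suc [] f = refl
allFin-map-suc (i ∷ l) f = cong (f (suc i) ∧_) (allFin-map-suc l f)

dot-embed : ∀ {n} (S : Subset n) (r : Fin n → Bool) y →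
  dot (λ j → r (List.lookup (members S) j)) y ≡ dot r (embed S y)
dot-embed [] r [] = refl
dot-embed (true ∷ S) r (b ∷ y) =
  cong ((r zero ∧ b) xor_) (trans (dot-map-suc (members S) r y) (dot-embed S (r ∘ suc) _))
dot-embed (false ∷ S) r y =
  trans (dot-map-suc (members S) r y)
        (trans (dot-embed S (r ∘ suc) y′) (cong (_xor dot (r ∘ suc) (embed S y′)) (sym (∧-zeroʳ (r zero)))))
  where y′ = cast (length-map Fin.suc (members S)) y

allFin-members : ∀ {n} (S : Subset n) (f : Fin n → Bool) →
  allFin (length (members S)) (λ i → f (List.lookup (members S) i))
  ≡ allFin n (λ i → not (lookup S i) ∨ f i)
allFin-members [] f = refl
allFin-members (true ∷ S) f =
  cong (f zero ∧_) (trans (allFin-map-suc (members S) f) (allFin-members S (f ∘ suc)))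
allFin-members (false ∷ S) f = trans (allFin-map-suc (members S) f) (allFin-members S (f ∘ suc))

kernel-induced : ∀ {n} (M : AdjMatrix n) (S : Subset n) y →
  kernel (length (members S)) (length (members S)) (induced M S) y ≡ annihilatedOn M S (embed S y)
kernel-induced M S y =
  trans (allFin-cong (length (members S)) (λ i → cong not (dot-embed S (M (List.lookup (members S) i)) y)))
        (allFin-members S (λ i → not (dot (M i) (embed S y))))

2^nullity≡nullCount : ∀ {n} (M : AdjMatrix n) (S : Subset n) → 2 ^ nullityInd M S ≡ nullCount M S
2^nullity≡nullCount {n} M S = begin
  2 ^ nullityInd M S                        ≡⟨ sym (count-kernel k k (induced M S)) ⟩
  count k (kernel k k (induced M S))        ≡⟨ count-cong k (kernel-induced M S) ⟩
  count k (annihilatedOn M S ∘ embed S)      ≡⟨ sym (count-supportedIn n S (annihilatedOn M S)) ⟩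
  nullCount M S                             ∎
  where
  open ≡-Reasoning
  k = length (members S)

rank+nullity : ∀ {n} (M : AdjMatrix n) (S : Subset n) → rankInd M S + nullityInd M S ≡ length (members S)
rank+nullity M S = m+[n∸m]≡n (rank≤ (length (members S)) (length (members S)) (induced M S))

2^-injective : ∀ {m n} → 2 ^ m ≡ 2 ^ n → m ≡ n
2^-injective {m} {n} e = trans (sym (⌊log₂[2^n]⌋≡n m)) (trans (cong ⌊log₂_⌋ e) (⌊log₂[2^n]⌋≡n n))

rank-nullity-transfer : ∀ {n} (M N : AdjMatrix n) (S T : Subset n) k →
  nullCount M S ≡ nullCount N T → length (members S) ≡ k + length (members T) →
  nullityInd M S ≡ nullityInd N T × rankInd M S ≡ k + rankInd N T
rank-nullity-transfer M N S T k counts sizes = same-nullity , shifted-rank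
  where
  same-nullity = 2^-injective (trans (2^nullity≡nullCount M S) (trans counts (sym (2^nullity≡nullCount N T))))
  shifted-rank = +-cancelʳ-≡ (nullityInd M S) (rankInd M S) (k + rankInd N T) (begin
    rankInd M S + nullityInd M S         ≡⟨ rank+nullity M S ⟩
    length (members S)                   ≡⟨ sizes ⟩
    k + length (members T)               ≡⟨ cong (k +_) (sym (rank+nullity N T)) ⟩
    k + (rankInd N T + nullityInd N T)   ≡⟨ sym (+-assoc k (rankInd N T) _) ⟩
    k + rankInd N T + nullityInd N T     ≡⟨ cong (k + rankInd N T +_) (sym same-nullity) ⟩
    k + rankInd N T + nullityInd M S     ∎)
    where open ≡-Reasoning

size-update : ∀ {n} (S : Subset n) a →
  length (members (S [ a ]≔ true)) ≡ suc (length (members (S [ a ]≔ false)))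
size-update-map : ∀ {n} (S : Subset n) a →
  length (map Fin.suc (members (S [ a ]≔ true))) ≡ suc (length (map Fin.suc (members (S [ a ]≔ false))))

size-update (_ ∷ S) zero = refl
size-update (true ∷ S) (suc a) = cong suc (size-update-map S a)
size-update (false ∷ S) (suc a) = size-update-map S a

size-update-map S a = trans (length-map Fin.suc (members (S [ a ]≔ true)))
  (trans (size-update S a) (cong suc (sym (length-map Fin.suc (members (S [ a ]≔ false))))))

⌊≟⌋-refl : ∀ {n} (u : Fin n) → ⌊ u ≟F u ⌋ ≡ true
⌊≟⌋-refl u with u ≟F u
... | yes _ = refl
... | no u≢u = ⊥-elim (u≢u refl)

⌊≟⌋-≢ : ∀ {n} {u v : Fin n} → u ≢ v → ⌊ u ≟F v ⌋ ≡ false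
⌊≟⌋-≢ {u = u} {v} u≢v with u ≟F v
... | yes u≡v = ⊥-elim (u≢v u≡v)
... | no _ = refl

⌊suc≟suc⌋ : ∀ {n} (i a : Fin n) → ⌊ suc i ≟F suc a ⌋ ≡ ⌊ i ≟F a ⌋
⌊suc≟suc⌋ i a with i ≟F a | suc i ≟F suc a
... | yes _ | yes _ = refl
... | yes i≡a | no si≢sa = ⊥-elim (si≢sa (cong suc i≡a))
... | no i≢a | yes si≡sa = ⊥-elim (i≢a (suc-injective si≡sa))
... | no _ | no _ = refl

data Position {n} (a b : Fin n) (j : Fin n) : Set where
  at-a : j ≡ a → Position a b j
  at-b : j ≡ b → Position a b j
  elsewhere : j ≢ a → j ≢ b → Position a b j

position : ∀ {n} (a b j : Fin n) → Position a b j
position a b j with j ≟F a | j ≟F b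
... | yes j≡a | _ = at-a j≡a
... | no _ | yes j≡b = at-b j≡b
... | no j≢a | no j≢b = elsewhere j≢a j≢b

outside-≢ : ∀ {n} {a b u : Fin n} → u ≢ a → u ≢ b → outside a b u ≡ true
outside-≢ u≢a u≢b rewrite ⌊≟⌋-≢ u≢a | ⌊≟⌋-≢ u≢b = refl

pivot-untouched : ∀ {n} (M : AdjMatrix n) (a b u w : Fin n) →
  outside a b u ≡ false ⊎ outside a b w ≡ false → pivot M a b u w ≡ M u w
pivot-untouched M a b u w endpoint with ⌊ u ≟F w ⌋
... | true = refl
... | false = trans (cong (M u w xor_) (cong₂ _∨_ (no-toggle u w endpoint) (no-toggle w u (swap endpoint))))
                    (xor-identityʳ (M u w))
  where
  no-toggle : ∀ u w → outside a b u ≡ false ⊎ outside a b w ≡ false → pivotCond M a b u w ≡ false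
  no-toggle u w (inj₁ e) rewrite e = refl
  no-toggle u w (inj₂ e) rewrite e = ∧-zeroʳ (outside a b u)

module _ {n} (M : AdjMatrix n) (a b : Fin n) where

  outside-a : outside a b a ≡ false
  outside-a rewrite ⌊≟⌋-refl a = refl

  outside-b : outside a b b ≡ false
  outside-b rewrite ⌊≟⌋-refl b = ∧-zeroʳ (not ⌊ b ≟F a ⌋)

  pivot-row-a : ∀ w → pivot M a b a w ≡ M a w
  pivot-row-a w = pivot-untouched M a b a w (inj₁ outside-a)

  pivot-row-b : ∀ w → pivot M a b b w ≡ M b w
  pivot-row-b w = pivot-untouched M a b b w (inj₁ outside-b)

  pivot-column-a : ∀ u → pivot M a b u a ≡ M u a
  pivot-column-a u = pivot-untouched M a b u a (inj₂ outside-a)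

  pivot-column-b : ∀ u → pivot M a b u b ≡ M u b
  pivot-column-b u = pivot-untouched M a b u b (inj₂ outside-b)

toggle-condition : ∀ A B C D →
  (A ∧ (B ∧ (not C ∨ not D))) ∨ (D ∧ (C ∧ (not B ∨ not A))) ≡ (A ∧ B) xor (D ∧ C)
toggle-condition true true true true = refl
toggle-condition true true true false = refl
toggle-condition true true false true = refl
toggle-condition true true false false = refl
toggle-condition true false true true = refl
toggle-condition true false true false = refl
toggle-condition true false false true = refl
toggle-condition true false false false = refl
toggle-condition false true true true = refl
toggle-condition false true true false = refl
toggle-condition false true false true = refl
toggle-condition false true false false = refl
toggle-condition false false true true = refl
toggle-condition false false true false = refl
toggle-condition false false false true = refl
toggle-condition false false false false = refl

-- For u = w the added term vanishes, which matches that loops are not toggled.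
pivot-inner : ∀ {n} (M : AdjMatrix n) (a b u w : Fin n) → u ≢ a → u ≢ b → w ≢ a → w ≢ b →
  pivot M a b u w ≡ M u w xor ((M u a ∧ M w b) xor (M w a ∧ M u b))
pivot-inner M a b u w u≢a u≢b w≢a w≢b with u ≟F w
... | yes refl = sym (trans (cong (M u u xor_) (xor-same (M u a ∧ M u b))) (xor-identityʳ (M u u)))
... | no _ rewrite outside-≢ {a = a} {b} u≢a u≢b | outside-≢ {a = a} {b} w≢a w≢b =
  cong (M u w xor_) (toggle-condition (M u a) (M w b) (M u b) (M w a))

pivot-symmetric : ∀ {n} (M : AdjMatrix n) (a b : Fin n) → SymmetricAdj M → SymmetricAdj (pivot M a b)
pivot-symmetric M a b M-sym u w with u ≟F w | w ≟F u
... | yes refl | yes _ = refl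
... | yes refl | no w≢w = ⊥-elim (w≢w refl)
... | no u≢w | yes w≡u = ⊥-elim (u≢w (sym w≡u))
... | no _ | no _ = cong₂ _xor_ (M-sym u w) (∨-comm (pivotCond M a b u w) (pivotCond M a b w u))

pivot-involutive : ∀ {n} (M : AdjMatrix n) (a b u w : Fin n) → pivot (pivot M a b) a b u w ≡ M u w
pivot-involutive M a b u w with position a b u | position a b w
... | at-a refl | _ = trans (pivot-row-a (pivot M a b) a b w) (pivot-row-a M a b w)
... | at-b refl | _ = trans (pivot-row-b (pivot M a b) a b w) (pivot-row-b M a b w)
... | elsewhere _ _ | at-a refl = trans (pivot-column-a (pivot M a b) a b u) (pivot-column-a M a b u)
... | elsewhere _ _ | at-b refl = trans (pivot-column-b (pivot M a b) a b u) (pivot-column-b M a b u)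
... | elsewhere u≢a u≢b | elsewhere w≢a w≢b = begin
  pivot (pivot M a b) a b u w
    ≡⟨ pivot-inner (pivot M a b) a b u w u≢a u≢b w≢a w≢b ⟩
  pivot M a b u w xor ((M′ u a ∧ M′ w b) xor (M′ w a ∧ M′ u b))
    ≡⟨ cong₂ _xor_ (pivot-inner M a b u w u≢a u≢b w≢a w≢b)
                   (cong₂ _xor_ (cong₂ _∧_ (pivot-column-a M a b u) (pivot-column-b M a b w))
                                (cong₂ _∧_ (pivot-column-a M a b w) (pivot-column-b M a b u))) ⟩
  (M u w xor t) xor t
    ≡⟨ cancel (M u w) t ⟩
  M u w ∎
  where
  open ≡-Reasoning
  M′ = pivot M a b
  t = (M u a ∧ M w b) xor (M w a ∧ M u b)
  cancel : ∀ p q → (p xor q) xor q ≡ p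
  cancel = solve-∀ GF2

pivot-comm : ∀ {n} (M : AdjMatrix n) (a b u w : Fin n) → pivot M b a u w ≡ pivot M a b u w
pivot-comm M a b u w with position a b u | position a b w
... | at-a refl | _ = trans (pivot-row-b M b a w) (sym (pivot-row-a M a b w))
... | at-b refl | _ = trans (pivot-row-a M b a w) (sym (pivot-row-b M a b w))
... | elsewhere _ _ | at-a refl = trans (pivot-column-b M b a u) (sym (pivot-column-a M a b u))
... | elsewhere _ _ | at-b refl = trans (pivot-column-a M b a u) (sym (pivot-column-b M a b u))
... | elsewhere u≢a u≢b | elsewhere w≢a w≢b =
  trans (pivot-inner M b a u w u≢b u≢a w≢b w≢a)
        (trans (reorder (M u w) (M u b) (M w a) (M w b) (M u a))
               (sym (pivot-inner M a b u w u≢a u≢b w≢a w≢b)))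
  where
  reorder : ∀ m p q r s → m xor ((p ∧ q) xor (r ∧ s)) ≡ m xor ((s ∧ r) xor (q ∧ p))
  reorder = solve-∀ GF2

-- Null counts under pivoting

module PivotNullity {n} (M : AdjMatrix n) (a b : Fin n) (M-sym : SymmetricAdj M) (a≢b : a ≢ b)
  (Mab : M a b ≡ true) (Maa : M a a ≡ false) (Mbb : M b b ≡ false) where

  M′ : AdjMatrix n
  M′ = pivot M a b

  b≢a : b ≢ a
  b≢a = a≢b ∘ sym

  Mba : M b a ≡ true
  Mba = trans (M-sym b a) Mab

  pivot-row-inner : ∀ i → i ≢ a → i ≢ b → ∀ y → lookup y a ≡ false → lookup y b ≡ false →
    dot (M′ i) y ≡ (dot (M i) y xor (M i a ∧ dot (M b) y)) xor (M i b ∧ dot (M a) y)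
  pivot-row-inner i i≢a i≢b y ya yb = begin
    dot (M′ i) y
      ≡⟨ dot-cong-support y entry ⟩
    dot (λ j → (M i j xor (M i a ∧ M b j)) xor (M i b ∧ M a j)) y
      ≡⟨ dot-linear (λ j → M i j xor (M i a ∧ M b j)) (M a) (M i b) y ⟩
    dot (λ j → M i j xor (M i a ∧ M b j)) y xor (M i b ∧ dot (M a) y)
      ≡⟨ cong (_xor (M i b ∧ dot (M a) y)) (dot-linear (M i) (M b) (M i a) y) ⟩
    (dot (M i) y xor (M i a ∧ dot (M b) y)) xor (M i b ∧ dot (M a) y) ∎
    where
    open ≡-Reasoning
    regroup : ∀ m p q r s → m xor ((p ∧ q) xor (r ∧ s)) ≡ (m xor (p ∧ q)) xor (s ∧ r)
    regroup = solve-∀ GF2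
    entry : ∀ j → lookup y j ≡ true → M′ i j ≡ (M i j xor (M i a ∧ M b j)) xor (M i b ∧ M a j)
    entry j yj =
      trans (pivot-inner M a b i j i≢a i≢b (≢-by-lookup y yj ya true≢false) (≢-by-lookup y yj yb true≢false))
            (trans (cong₂ (λ u v → M i j xor ((M i a ∧ u) xor (v ∧ M i b))) (M-sym j b) (M-sym j a))
                   (regroup (M i j) (M i a) (M b j) (M a j) (M i b)))

  -- The shear replacing x_a by (Mx)_b carries the null space of M′ on X onto that of M.
  module OneEndpoint (X : Subset n) (Xa : lookup X a ≡ true) (Xb : lookup X b ≡ false) where

    g : Vec Bool n → Bool
    g x = dot (M b) (x [ a ]≔ false)

    shear : Vec Bool n → Vec Bool n
    shear x = x [ a ]≔ (lookup x a xor g x)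

    g-independent : IndependentOf a g
    g-independent x c = cong (dot (M b)) ([]≔-idempotent x a)

    shear-elsewhere : ∀ x j → j ≢ a → lookup (shear x) j ≡ lookup x j
    shear-elsewhere x j j≢a = lookup∘update′ j≢a x _

    row-a : ∀ x → dot (M′ a) x ≡ dot (M a) (shear x)
    row-a x = trans (dot-cong x (pivot-row-a M a b)) (sym (dot-update-irrelevant (M a) x a _ Maa))

    row-inner : ∀ x → lookup x b ≡ false → dot (M a) x ≡ false → ∀ i → i ≢ a → i ≢ b →
      dot (M′ i) x ≡ dot (M i) (shear x)
    row-inner x xb ra i i≢a i≢b = begin
      dot (M′ i) x
        ≡⟨ dot-update (M′ i) x a ⟩
      dot (M′ i) y xor (M′ i a ∧ lookup x a)
        ≡⟨ cong₂ (λ u v → u xor (v ∧ lookup x a))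
                 (pivot-row-inner i i≢a i≢b y ya yb) (pivot-column-a M a b i) ⟩
      ((dot (M i) y xor (M i a ∧ g x)) xor (M i b ∧ dot (M a) y)) xor (M i a ∧ lookup x a)
        ≡⟨ cong (λ v → ((dot (M i) y xor (M i a ∧ g x)) xor (M i b ∧ v)) xor (M i a ∧ lookup x a))
                (trans (dot-update-irrelevant (M a) x a false Maa) ra) ⟩
      ((dot (M i) y xor (M i a ∧ g x)) xor (M i b ∧ false)) xor (M i a ∧ lookup x a)
        ≡⟨ collect (dot (M i) y) (M i a) (g x) (M i b) (lookup x a) ⟩
      dot (M i) y xor (M i a ∧ (lookup x a xor g x))
        ≡⟨ sym (cong₂ (λ u v → dot (M i) u xor (M i a ∧ v)) ([]≔-idempotent x a) (lookup∘update a x _)) ⟩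
      dot (M i) (shear x [ a ]≔ false) xor (M i a ∧ lookup (shear x) a)
        ≡⟨ sym (dot-update (M i) (shear x) a) ⟩
      dot (M i) (shear x) ∎
      where
      open ≡-Reasoning
      y = x [ a ]≔ false
      ya = lookup∘update a x false
      yb = trans (lookup∘update′ b≢a x false) xb
      collect : ∀ d p s q t → ((d xor (p ∧ s)) xor (q ∧ false)) xor (p ∧ t) ≡ d xor (p ∧ (t xor s))
      collect = solve-∀ GF2

    rows : ∀ x → lookup x b ≡ false → dot (M a) x ≡ false → ∀ i → lookup X i ≡ true →
      dot (M′ i) x ≡ dot (M i) (shear x)
    rows x xb ra i Xi with position a b i
    ... | at-a refl = row-a x
    ... | at-b refl = ⊥-elim (true≢false (trans (sym Xi) Xb))
    ... | elsewhere i≢a i≢b = row-inner x xb ra i i≢a i≢b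

    nullSpace-shear : ∀ x → nullSpace M′ X x ≡ nullSpace M X (shear x)
    nullSpace-shear x = nullSpace-≡ M′ M X X x (shear x) to from
      where
      ∉X⇒≢a : ∀ j → lookup X j ≡ false → j ≢ a
      ∉X⇒≢a j Xj = ≢-by-lookup X Xj Xa (true≢false ∘ sym)
      to : Supported X x × Annihilated M′ X x → Supported X (shear x) × Annihilated M X (shear x)
      to (s , k) = (λ j Xj → trans (shear-elsewhere x j (∉X⇒≢a j Xj)) (s j Xj))
                 , (λ i Xi → trans (sym (rows x (s b Xb) ra i Xi)) (k i Xi))
        where ra = trans (sym (dot-cong x (pivot-row-a M a b))) (k a Xa)
      from : Supported X (shear x) × Annihilated M X (shear x) → Supported X x × Annihilated M′ X x
      from (s , k) = supported , (λ i Xi → trans (rows x (supported b Xb) ra i Xi) (k i Xi))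
        where
        supported : Supported X x
        supported j Xj = trans (sym (shear-elsewhere x j (∉X⇒≢a j Xj))) (s j Xj)
        ra = trans (sym (dot-update-irrelevant (M a) x a _ Maa)) (k a Xa)

    nullCount-pivot : nullCount M′ X ≡ nullCount M X
    nullCount-pivot = trans (count-cong n nullSpace-shear) (count-shear n a g (nullSpace M X) g-independent)

  -- With a, b ∈ X and Z = X ∖ {a,b}: since M_ab = 1, rows b and a of M solve for x_a and x_b,
  -- and what remains of the null space on X is the null space of M′ on Z.
  module BothEndpoints (X Z : Subset n) (Xa : lookup X a ≡ true) (Xb : lookup X b ≡ true)
    (Za : lookup Z a ≡ false) (Zb : lookup Z b ≡ false)
    (X≗Z : ∀ j → j ≢ a → j ≢ b → lookup X j ≡ lookup Z j) where

    strip : Vec Bool n → Vec Bool n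
    strip x = (x [ b ]≔ false) [ a ]≔ false

    forcedA forcedB : Vec Bool n → Bool
    forcedA x = dot (M b) (x [ a ]≔ false)
    forcedB x = dot (M a) (x [ b ]≔ false)

    strip-a : ∀ x → lookup (strip x) a ≡ false
    strip-a x = lookup∘update a (x [ b ]≔ false) false

    strip-b : ∀ x → lookup (strip x) b ≡ false
    strip-b x = trans (lookup∘update′ b≢a (x [ b ]≔ false) false) (lookup∘update b x false)

    strip-elsewhere : ∀ x j → j ≢ a → j ≢ b → lookup (strip x) j ≡ lookup x j
    strip-elsewhere x j j≢a j≢b =
      trans (lookup∘update′ j≢a (x [ b ]≔ false) false) (lookup∘update′ j≢b x false)

    row-b : ∀ x → dot (M b) x ≡ forcedA x xor lookup x a
    row-b x = trans (dot-update (M b) x a) (cong (λ v → forcedA x xor (v ∧ lookup x a)) Mba)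

    row-a : ∀ x → dot (M a) x ≡ forcedB x xor lookup x b
    row-a x = trans (dot-update (M a) x b) (cong (λ v → forcedB x xor (v ∧ lookup x b)) Mab)

    dot-strip : ∀ r x → dot r x ≡ (dot r (strip x) xor (r a ∧ lookup x a)) xor (r b ∧ lookup x b)
    dot-strip r x = trans (dot-update r x b) (cong (_xor (r b ∧ lookup x b))
      (trans (dot-update r (x [ b ]≔ false) a)
             (cong (λ v → dot r (strip x) xor (r a ∧ v)) (lookup∘update′ a≢b x false))))

    dot-strip-b : ∀ x → dot (M b) (strip x) ≡ forcedA x
    dot-strip-b x = trans (cong (dot (M b)) ([]≔-commutes x b a b≢a))
                          (dot-update-irrelevant (M b) (x [ a ]≔ false) b false Mbb)

    dot-strip-a : ∀ x → dot (M a) (strip x) ≡ forcedB x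
    dot-strip-a x = dot-update-irrelevant (M a) (x [ b ]≔ false) a false Maa

    row-inner : ∀ x → lookup x a ≡ forcedA x → lookup x b ≡ forcedB x → ∀ i → i ≢ a → i ≢ b →
      dot (M i) x ≡ dot (M′ i) (strip x)
    row-inner x xa xb i i≢a i≢b = begin
      dot (M i) x
        ≡⟨ dot-strip (M i) x ⟩
      (dot (M i) (strip x) xor (M i a ∧ lookup x a)) xor (M i b ∧ lookup x b)
        ≡⟨ cong₂ (λ u v → (dot (M i) (strip x) xor (M i a ∧ u)) xor (M i b ∧ v))
                 (trans xa (sym (dot-strip-b x))) (trans xb (sym (dot-strip-a x))) ⟩
      (dot (M i) (strip x) xor (M i a ∧ dot (M b) (strip x))) xor (M i b ∧ dot (M a) (strip x))
        ≡⟨ sym (pivot-row-inner i i≢a i≢b (strip x) (strip-a x) (strip-b x)) ⟩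
      dot (M′ i) (strip x) ∎
      where open ≡-Reasoning

    Q : Vec Bool n → Bool
    Q = nullSpace M′ Z

    solved : Vec Bool n → Bool
    solved x = not (lookup x a xor forcedA x) ∧ (not (lookup x b xor forcedB x) ∧ Q (strip x))

    nullSpace⇒solved : ∀ x → nullSpace M X x ≡ true → solved x ≡ true
    nullSpace⇒solved x h = Equivalence.from ∧-≡true (Equivalence.from not-xor-≡true xa ,
      Equivalence.from ∧-≡true (Equivalence.from not-xor-≡true xb ,
        Equivalence.from (nullSpace-≡true M′ Z (strip x)) (supported , annihilated)))
      where
      s = proj₁ (Equivalence.to (nullSpace-≡true M X x) h)
      k = proj₂ (Equivalence.to (nullSpace-≡true M X x) h)
      xa = sym (xor-≡false (trans (sym (row-b x)) (k b Xb)))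
      xb = sym (xor-≡false (trans (sym (row-a x)) (k a Xa)))
      supported : Supported Z (strip x)
      supported j Zj with position a b j
      ... | at-a refl = strip-a x
      ... | at-b refl = strip-b x
      ... | elsewhere j≢a j≢b = trans (strip-elsewhere x j j≢a j≢b) (s j (trans (X≗Z j j≢a j≢b) Zj))
      annihilated : Annihilated M′ Z (strip x)
      annihilated i Zi = trans (sym (row-inner x xa xb i i≢a i≢b)) (k i (trans (X≗Z i i≢a i≢b) Zi))
        where
        i≢a = ≢-by-lookup Z Zi Za true≢false
        i≢b = ≢-by-lookup Z Zi Zb true≢false

    solved⇒nullSpace : ∀ x → solved x ≡ true → nullSpace M X x ≡ true
    solved⇒nullSpace x h = Equivalence.from (nullSpace-≡true M X x) (supported , annihilated)
      where
      xa = Equivalence.to not-xor-≡true (proj₁ (Equivalence.to ∧-≡true h))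
      rest = proj₂ (Equivalence.to (∧-≡true {not (lookup x a xor forcedA x)}) h)
      xb = Equivalence.to not-xor-≡true (proj₁ (Equivalence.to ∧-≡true rest))
      sk = Equivalence.to (nullSpace-≡true M′ Z (strip x))
             (proj₂ (Equivalence.to (∧-≡true {not (lookup x b xor forcedB x)}) rest))
      supported : Supported X x
      supported j Xj with position a b j
      ... | at-a refl = ⊥-elim (true≢false (trans (sym Xa) Xj))
      ... | at-b refl = ⊥-elim (true≢false (trans (sym Xb) Xj))
      ... | elsewhere j≢a j≢b =
        trans (sym (strip-elsewhere x j j≢a j≢b)) (proj₁ sk j (trans (sym (X≗Z j j≢a j≢b)) Xj))
      annihilated : Annihilated M X x
      annihilated i Xi with position a b i
      ... | at-a refl = trans (row-a x) (trans (cong (forcedB x xor_) xb) (xor-same (forcedB x)))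
      ... | at-b refl = trans (row-b x) (trans (cong (forcedA x xor_) xa) (xor-same (forcedA x)))
      ... | elsewhere i≢a i≢b =
        trans (row-inner x xa xb i i≢a i≢b) (proj₂ sk i (trans (sym (X≗Z i i≢a i≢b)) Xi))

    nullSpace-solve : ∀ x → nullSpace M X x ≡ solved x
    nullSpace-solve x = ⇔→≡ (mk⇔ (nullSpace⇒solved x) (solved⇒nullSpace x))

    strip-update-a : ∀ x c → strip (x [ a ]≔ c) ≡ strip x
    strip-update-a x c =
      trans (cong (_[ a ]≔ false) ([]≔-commutes x a b a≢b)) ([]≔-idempotent (x [ b ]≔ false) a)

    strip-update-b : ∀ x c → strip (x [ b ]≔ c) ≡ strip x
    strip-update-b x c = cong (_[ a ]≔ false) ([]≔-idempotent x b)

    forcedA-independent : IndependentOf a forcedA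
    forcedA-independent x c = cong (dot (M b)) ([]≔-idempotent x a)

    forcedB-independent : IndependentOf b forcedB
    forcedB-independent x c = cong (dot (M a)) ([]≔-idempotent x b)

    constraintB-independent : IndependentOf a (λ x → not (lookup x b xor forcedB x) ∧ Q (strip x))
    constraintB-independent x c = cong₂ (λ u v → not u ∧ Q v)
      (cong₂ _xor_ (lookup∘update′ b≢a x c)
         (trans (cong (dot (M a)) ([]≔-commutes x a b a≢b))
                (dot-update-irrelevant (M a) (x [ b ]≔ false) a c Maa)))
      (strip-update-a x c)

    clearedA-independent : IndependentOf b (λ x → not (lookup x a) ∧ Q (strip x))
    clearedA-independent x c = cong₂ (λ u v → not u ∧ Q v) (lookup∘update′ a≢b x c) (strip-update-b x c)

    Q-strip : ∀ x → Q x ≡ not (lookup x b) ∧ (not (lookup x a) ∧ Q (strip x))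
    Q-strip x = trans (nullSpace-clear M′ Z b Zb x)
      (cong (not (lookup x b) ∧_) (trans (nullSpace-clear M′ Z a Za (x [ b ]≔ false))
        (cong (λ u → not u ∧ Q (strip x)) (lookup∘update′ a≢b x false))))

    nullCount-pivot : nullCount M X ≡ nullCount M′ Z
    nullCount-pivot = begin
      count n (nullSpace M X)
        ≡⟨ count-cong n nullSpace-solve ⟩
      count n (λ x → not (lookup x a xor forcedA x) ∧ (not (lookup x b xor forcedB x) ∧ Q (strip x)))
        ≡⟨ count-pin n a forcedA _ forcedA-independent constraintB-independent ⟩
      count n (λ x → not (lookup x a) ∧ (not (lookup x b xor forcedB x) ∧ Q (strip x)))
        ≡⟨ count-cong n (λ x → ∧-swap (not (lookup x a)) (not (lookup x b xor forcedB x)) (Q (strip x))) ⟩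
      count n (λ x → not (lookup x b xor forcedB x) ∧ (not (lookup x a) ∧ Q (strip x)))
        ≡⟨ count-pin n b forcedB _ forcedB-independent clearedA-independent ⟩
      count n (λ x → not (lookup x b) ∧ (not (lookup x a) ∧ Q (strip x)))
        ≡⟨ count-cong n (λ x → sym (Q-strip x)) ⟩
      count n Q ∎
      where open ≡-Reasoning

module WeightedSums {c ℓ} (R : CommutativeRing c ℓ) where
  open CommutativeRing R
    using (Carrier; _≈_; _*_; 1#; *-cong; *-congˡ; *-identityˡ; distribˡ;
           +-commutativeMonoid; *-commutativeMonoid)
    renaming (_+_ to _+ᴿ_; +-cong to +ᴿ-cong; +-identityˡ to +ᴿ-identityˡ; +-identityʳ to +ᴿ-identityʳ;
              +-assoc to +ᴿ-assoc; refl to ≈-refl; sym to ≈-sym; trans to ≈-trans; reflexive to ≈-reflexive)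
  open Interlace R
  open import Relation.Binary.Reasoning.Setoid (CommutativeRing.setoid R)
  open CubeSum +-commutativeMonoid public using (∑; ∑-cong; quadrupleAt; ∑-quadruple)
  open import Algebra.Properties.CommutativeSemigroup (CommutativeMonoid.commutativeSemigroup *-commutativeMonoid)
    using (x∙yz≈y∙xz)

  sumL-++ : ∀ (us vs : List Carrier) → sumL (us List.++ vs) ≈ sumL us +ᴿ sumL vs
  sumL-++ [] vs = ≈-sym (+ᴿ-identityˡ _)
  sumL-++ (u ∷ us) vs = ≈-trans (+ᴿ-cong ≈-refl (sumL-++ us vs)) (≈-sym (+ᴿ-assoc _ _ _))

  sumL-allSubsets : ∀ n (f : Vec Bool n → Carrier) → sumL (map f (allSubsets n)) ≈ ∑ n f
  sumL-allSubsets zero f = +ᴿ-identityʳ _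
  sumL-allSubsets (suc n) f = begin
    sumL (map f (map (true ∷_) S List.++ map (false ∷_) S))
      ≡⟨ cong sumL (map-++ f (map (true ∷_) S) (map (false ∷_) S)) ⟩
    sumL (map f (map (true ∷_) S) List.++ map f (map (false ∷_) S))
      ≈⟨ sumL-++ (map f (map (true ∷_) S)) (map f (map (false ∷_) S)) ⟩
    sumL (map f (map (true ∷_) S)) +ᴿ sumL (map f (map (false ∷_) S))
      ≡⟨ cong₂ (λ u v → sumL u +ᴿ sumL v) (sym (map-∘ S)) (sym (map-∘ S)) ⟩
    sumL (map (f ∘ (true ∷_)) S) +ᴿ sumL (map (f ∘ (false ∷_)) S)
      ≈⟨ +ᴿ-cong (sumL-allSubsets n (f ∘ (true ∷_))) (sumL-allSubsets n (f ∘ (false ∷_))) ⟩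
    ∑ (suc n) f ∎
    where S = allSubsets n

  *-∑ : ∀ n u (f : Vec Bool n → Carrier) → u * ∑ n f ≈ ∑ n (λ x → u * f x)
  *-∑ zero u f = ≈-refl
  *-∑ (suc n) u f = ≈-trans (distribˡ _ _ _) (+ᴿ-cong (*-∑ n u _) (*-∑ n u _))

  unit-at : ∀ {n} → Fin n → (Fin n → Carrier) → Fin n → Carrier
  unit-at a γ v = if ⌊ v ≟F a ⌋ then 1# else γ v

  weightProd-cong : ∀ {n} {α β α′ β′ : Fin n → Carrier} x →
    (∀ i → α i ≡ α′ i) → (∀ i → β i ≡ β′ i) →
    weightProd α β x ≈ weightProd α′ β′ x
  weightProd-cong [] eqα eqβ = ≈-refl
  weightProd-cong (true ∷ x) eqα eqβ =
    *-cong (≈-reflexive (eqα zero)) (weightProd-cong x (eqα ∘ suc) (eqβ ∘ suc))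
  weightProd-cong (false ∷ x) eqα eqβ =
    *-cong (≈-reflexive (eqβ zero)) (weightProd-cong x (eqα ∘ suc) (eqβ ∘ suc))

  unit-at-suc : ∀ {n} (γ : Fin (suc n) → Carrier) a i → unit-at a (γ ∘ suc) i ≡ unit-at (suc a) γ (suc i)
  unit-at-suc γ a i = cong (if_then 1# else γ (suc i)) (sym (⌊suc≟suc⌋ i a))

  weightProd-update : ∀ {n} (α β : Fin n → Carrier) x a s →
    weightProd α β (x [ a ]≔ s) ≈ (if s then α a else β a) * weightProd (unit-at a α) (unit-at a β) x
  weightProd-update α β (true ∷ x) zero true = ≈-sym (*-congˡ (*-identityˡ _))
  weightProd-update α β (false ∷ x) zero true = ≈-sym (*-congˡ (*-identityˡ _))
  weightProd-update α β (true ∷ x) zero false = ≈-sym (*-congˡ (*-identityˡ _))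
  weightProd-update α β (false ∷ x) zero false = ≈-sym (*-congˡ (*-identityˡ _))
  weightProd-update α β (true ∷ x) (suc a) s =
    ≈-trans (*-congˡ (weightProd-update (α ∘ suc) (β ∘ suc) x a s))
      (≈-trans (x∙yz≈y∙xz _ _ _)
               (*-congˡ (*-congˡ (weightProd-cong x (unit-at-suc α a) (unit-at-suc β a)))))
  weightProd-update α β (false ∷ x) (suc a) s =
    ≈-trans (*-congˡ (weightProd-update (α ∘ suc) (β ∘ suc) x a s))
      (≈-trans (x∙yz≈y∙xz _ _ _)
               (*-congˡ (*-congˡ (weightProd-cong x (unit-at-suc α a) (unit-at-suc β a)))))

module PivotIdentity {c ℓ} (R : CommutativeRing c ℓ) (x y : CommutativeRing.Carrier R)
  {n} (M : AdjMatrix n) (α β : Fin n → CommutativeRing.Carrier R) (a b : Fin n)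
  (M-sym : SymmetricAdj M) (a≢b : a ≢ b) (Mab : M a b ≡ true) (Maa : M a a ≡ false) (Mbb : M b b ≡ false)
  where

  open CommutativeRing R
    using (Carrier; _≈_; _*_; _-_; 1#; *-cong; *-congˡ; *-congʳ; +-commutativeMonoid; *-commutativeMonoid)
    renaming (_+_ to _+ᴿ_; +-cong to +ᴿ-cong;
              refl to ≈-refl; sym to ≈-sym; trans to ≈-trans; reflexive to ≈-reflexive)
  open Interlace R
  open WeightedSums R
  open PivotNullity M a b M-sym a≢b Mab Maa Mbb using (M′; b≢a; Mba; module OneEndpoint; module BothEndpoints)
  module Pivoted = PivotNullity M′ a b (pivot-symmetric M a b M-sym) a≢b
    (trans (pivot-row-a M a b b) Mab) (trans (pivot-row-a M a b a) Maa) (trans (pivot-row-b M a b b) Mbb)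
  module Swapped = PivotNullity M b a M-sym b≢a Mba Mbb Maa
  module ×-Solver = Algebra.Solver.CommutativeMonoid *-commutativeMonoid
  module +-Solver = Algebra.Solver.CommutativeMonoid +-commutativeMonoid
  open import Relation.Binary.Reasoning.Setoid (CommutativeRing.setoid R)

  p p² : Carrier
  p = x - 1#
  p² = pow p 2

  α′ β′ : Fin n → Carrier
  α′ = alpha' x α β a b
  β′ = beta' x α β a b

  term : AdjMatrix n → (Fin n → Carrier) → (Fin n → Carrier) → Subset n → Carrier
  term N γ δ S = weightProd γ δ S * (pow p (rankInd N S) * pow (y - 1#) (nullityInd N S))

  primed-a : ∀ s → (if s then α′ a else β′ a) ≡ (if s then β b else α b * p²)
  primed-a s rewrite ⌊≟⌋-refl a = refl

  primed-b : ∀ t → (if t then α′ b else β′ b) ≡ (if t then β a else α a * p²)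
  primed-b t rewrite ⌊≟⌋-≢ b≢a | ⌊≟⌋-refl b = refl

  unit-at-ab : (Fin n → Carrier) → Fin n → Carrier
  unit-at-ab γ = unit-at b (unit-at a γ)

  unit-at-ab-primed : ∀ v → unit-at-ab α′ v ≡ unit-at-ab α v × unit-at-ab β′ v ≡ unit-at-ab β v
  unit-at-ab-primed v with v ≟F b
  ... | yes _ = refl , refl
  ... | no _ with v ≟F a
  ...   | yes _ = refl , refl
  ...   | no _ = refl , refl

  module Quadruple (z : Subset n) where

    X : Bool → Bool → Subset n
    X s t = assign a b s t z

    X-a : ∀ s t → lookup (X s t) a ≡ s
    X-a s t = lookup∘update a (z [ b ]≔ t) s

    X-b : ∀ s t → lookup (X s t) b ≡ t
    X-b s t = trans (lookup∘update′ b≢a (z [ b ]≔ t) s) (lookup∘update b z t)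

    X-elsewhere : ∀ s t s′ t′ j → j ≢ a → j ≢ b → lookup (X s t) j ≡ lookup (X s′ t′) j
    X-elsewhere s t s′ t′ j j≢a j≢b =
      trans (lookup∘update′ j≢a (z [ b ]≔ t) s)
        (trans (lookup∘update′ j≢b z t)
               (sym (trans (lookup∘update′ j≢a (z [ b ]≔ t′) s′) (lookup∘update′ j≢b z t′))))

    size-X : length (members (X true true)) ≡ 2 + length (members (X false false))
    size-X = trans (size-update (z [ b ]≔ true) a)
      (cong suc (trans (cong (length ∘ members) ([]≔-commutes z b a b≢a))
        (trans (size-update (z [ a ]≔ false) b)
               (cong (suc ∘ length ∘ members) ([]≔-commutes z a b a≢b)))))

    W : Carrier
    W = weightProd (unit-at-ab α) (unit-at-ab β) z

    unit-at-a-keeps-b : ∀ (γ δ : Fin n → Carrier) t →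
      (if t then unit-at a γ b else unit-at a δ b) ≡ (if t then γ b else δ b)
    unit-at-a-keeps-b γ δ t rewrite ⌊≟⌋-≢ b≢a = refl

    weights : ∀ s t → weightProd α β (X s t) ≈ (if s then α a else β a) * ((if t then α b else β b) * W)
    weights s t = ≈-trans (weightProd-update α β (z [ b ]≔ t) a s)
      (*-congˡ (≈-trans (weightProd-update (unit-at a α) (unit-at a β) z b t)
                        (*-congʳ (≈-reflexive (unit-at-a-keeps-b α β t)))))

    weights′ : ∀ s t →
      weightProd α′ β′ (X s t) ≈ (if s then β b else α b * p²) * ((if t then β a else α a * p²) * W)
    weights′ s t = ≈-trans (weightProd-update α′ β′ (z [ b ]≔ t) a s)
      (*-cong (≈-reflexive (primed-a s))
        (≈-trans (weightProd-update (unit-at a α′) (unit-at a β′) z b t)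
                 (*-cong (≈-reflexive (trans (unit-at-a-keeps-b α′ β′ t) (primed-b t)))
                         (weightProd-cong z (proj₁ ∘ unit-at-ab-primed) (proj₂ ∘ unit-at-ab-primed)))))

    both-in : nullityInd M (X true true) ≡ nullityInd M′ (X false false)
            × rankInd M (X true true) ≡ 2 + rankInd M′ (X false false)
    both-in = rank-nullity-transfer M M′ (X true true) (X false false) 2
      (BothEndpoints.nullCount-pivot (X true true) (X false false) (X-a true true) (X-b true true)
         (X-a false false) (X-b false false) (X-elsewhere true true false false))
      size-X

    both-in′ : nullityInd M′ (X true true) ≡ nullityInd M (X false false)
             × rankInd M′ (X true true) ≡ 2 + rankInd M (X false false)
    both-in′ = rank-nullity-transfer M′ M (X true true) (X false false) 2
      (trans (Pivoted.BothEndpoints.nullCount-pivot (X true true) (X false false) (X-a true true) (X-b true true)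
                (X-a false false) (X-b false false) (X-elsewhere true true false false))
             (nullCount-cong (X false false) (pivot-involutive M a b)))
      size-X

    only-a : nullityInd M′ (X true false) ≡ nullityInd M (X true false)
           × rankInd M′ (X true false) ≡ 0 + rankInd M (X true false)
    only-a = rank-nullity-transfer M′ M (X true false) (X true false) 0
      (OneEndpoint.nullCount-pivot (X true false) (X-a true false) (X-b true false)) refl

    only-b : nullityInd M′ (X false true) ≡ nullityInd M (X false true)
           × rankInd M′ (X false true) ≡ 0 + rankInd M (X false true)
    only-b = rank-nullity-transfer M′ M (X false true) (X false true) 0
      (trans (nullCount-cong (X false true) (λ u w → sym (pivot-comm M a b u w)))
             (Swapped.OneEndpoint.nullCount-pivot (X false true) (X-b false true) (X-a false true)))
      refl

    powers : ∀ {r r′ k k′} → r ≡ r′ → k ≡ k′ →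
      pow p r * pow (y - 1#) k ≈ pow p r′ * pow (y - 1#) k′
    powers refl refl = ≈-refl

    open ×-Solver using (_⊕_; _⊜_; id)

    term-both : p² * term M α β (X true true) ≈ term M′ α′ β′ (X false false)
    term-both = begin
      p² * term M α β (X true true)
        ≈⟨ *-congˡ (*-cong (weights true true) (powers (proj₂ both-in) (proj₁ both-in))) ⟩
      p² * ((α a * (α b * W)) * ((p * (p * P)) * N))
        ≈⟨ ×-Solver.solve 6 (λ p A B W P N →
             (p ⊕ (p ⊕ id)) ⊕ ((A ⊕ (B ⊕ W)) ⊕ ((p ⊕ (p ⊕ P)) ⊕ N)) ⊜
             ((B ⊕ (p ⊕ (p ⊕ id))) ⊕ ((A ⊕ (p ⊕ (p ⊕ id))) ⊕ W)) ⊕ (P ⊕ N)) ≈-refl p (α a) (α b) W P N ⟩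
      ((α b * p²) * ((α a * p²) * W)) * (P * N)
        ≈⟨ *-congʳ (≈-sym (weights′ false false)) ⟩
      term M′ α′ β′ (X false false) ∎
      where
      P = pow p (rankInd M′ (X false false))
      N = pow (y - 1#) (nullityInd M′ (X false false))

    term-neither : p² * term M α β (X false false) ≈ term M′ α′ β′ (X true true)
    term-neither = begin
      p² * term M α β (X false false)
        ≈⟨ *-congˡ (*-congʳ (weights false false)) ⟩
      p² * ((β a * (β b * W)) * (P * N))
        ≈⟨ ×-Solver.solve 6 (λ p A B W P N →
             (p ⊕ (p ⊕ id)) ⊕ ((A ⊕ (B ⊕ W)) ⊕ (P ⊕ N)) ⊜
             (B ⊕ (A ⊕ W)) ⊕ ((p ⊕ (p ⊕ P)) ⊕ N)) ≈-refl p (β a) (β b) W P N ⟩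
      (β b * (β a * W)) * ((p * (p * P)) * N)
        ≈⟨ *-cong (≈-sym (weights′ true true))
                  (powers (sym (proj₂ both-in′)) (sym (proj₁ both-in′))) ⟩
      term M′ α′ β′ (X true true) ∎
      where
      P = pow p (rankInd M (X false false))
      N = pow (y - 1#) (nullityInd M (X false false))

    term-only-a : p² * term M α β (X true false) ≈ term M′ α′ β′ (X true false)
    term-only-a = begin
      p² * term M α β (X true false)
        ≈⟨ *-congˡ (*-congʳ (weights true false)) ⟩
      p² * ((α a * (β b * W)) * (P * N))
        ≈⟨ ×-Solver.solve 6 (λ p A B W P N →
             (p ⊕ (p ⊕ id)) ⊕ ((A ⊕ (B ⊕ W)) ⊕ (P ⊕ N)) ⊜
             (B ⊕ ((A ⊕ (p ⊕ (p ⊕ id))) ⊕ W)) ⊕ (P ⊕ N)) ≈-refl p (α a) (β b) W P N ⟩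
      (β b * ((α a * p²) * W)) * (P * N)
        ≈⟨ *-cong (≈-sym (weights′ true false))
                  (powers (sym (proj₂ only-a)) (sym (proj₁ only-a))) ⟩
      term M′ α′ β′ (X true false) ∎
      where
      P = pow p (rankInd M (X true false))
      N = pow (y - 1#) (nullityInd M (X true false))

    term-only-b : p² * term M α β (X false true) ≈ term M′ α′ β′ (X false true)
    term-only-b = begin
      p² * term M α β (X false true)
        ≈⟨ *-congˡ (*-congʳ (weights false true)) ⟩
      p² * ((β a * (α b * W)) * (P * N))
        ≈⟨ ×-Solver.solve 6 (λ p A B W P N →
             (p ⊕ (p ⊕ id)) ⊕ ((A ⊕ (B ⊕ W)) ⊕ (P ⊕ N)) ⊜
             ((B ⊕ (p ⊕ (p ⊕ id))) ⊕ (A ⊕ W)) ⊕ (P ⊕ N)) ≈-refl p (β a) (α b) W P N ⟩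
      ((α b * p²) * (β a * W)) * (P * N)
        ≈⟨ *-cong (≈-sym (weights′ false true))
                  (powers (sym (proj₂ only-b)) (sym (proj₁ only-b))) ⟩
      term M′ α′ β′ (X false true) ∎
      where
      P = pow p (rankInd M (X false true))
      N = pow (y - 1#) (nullityInd M (X false true))

  swap-outer : ∀ u v w t → (u +ᴿ v) +ᴿ (w +ᴿ t) ≈ (t +ᴿ v) +ᴿ (w +ᴿ u)
  swap-outer = +-Solver.solve 4 (λ u v w t → (u ⊕ v) ⊕ (w ⊕ t) ⊜ (t ⊕ v) ⊕ (w ⊕ u)) ≈-refl
    where open +-Solver using (_⊕_; _⊜_)

  quadruples : ∀ z → quadrupleAt a b (λ S → p² * term M α β S) z ≈ quadrupleAt a b (term M′ α′ β′) z
  quadruples z with lookup z b ∨ lookup z a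
  ... | true = ≈-refl
  ... | false =
    ≈-trans (+ᴿ-cong (+ᴿ-cong term-both term-only-b) (+ᴿ-cong term-only-a term-neither)) (swap-outer _ _ _ _)
    where open Quadruple z

  pivot-identity : p² * q x y M α β ≈ q x y M′ α′ β′
  pivot-identity = begin
    p² * q x y M α β                                ≈⟨ *-congˡ (sumL-allSubsets n (term M α β)) ⟩
    p² * ∑ n (term M α β)                           ≈⟨ *-∑ n p² (term M α β) ⟩
    ∑ n (λ S → p² * term M α β S)                   ≈⟨ ∑-quadruple n a≢b (λ S → p² * term M α β S) ⟩
    ∑ n (quadrupleAt a b (λ S → p² * term M α β S)) ≈⟨ ∑-cong n quadruples ⟩
    ∑ n (quadrupleAt a b (term M′ α′ β′))           ≈⟨ ∑-quadruple n a≢b (term M′ α′ β′) ⟨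
    ∑ n (term M′ α′ β′)                             ≈⟨ sumL-allSubsets n (term M′ α′ β′) ⟨
    q x y M′ α′ β′                                  ∎

corollary2 : ∀ {c ℓ} (R : CommutativeRing c ℓ) (x y : CommutativeRing.Carrier R)
  (n : ℕ) (M : AdjMatrix n) (α β : Fin n → CommutativeRing.Carrier R) (a b : Fin n) →
  SymmetricAdj M → a ≢ b → M a b ≡ true → M a a ≡ false → M b b ≡ false →
  CommutativeRing._≈_ R
    (CommutativeRing._*_ R (Interlace.pow R (CommutativeRing._-_ R x (CommutativeRing.1# R)) 2)
      (Interlace.q R x y M α β))
    (Interlace.q R x y (pivot M a b)
      (Interlace.alpha' R x α β a b) (Interlace.beta' R x α β a b))
corollary2 R x y n M α β a b M-sym a≢b Mab Maa Mbb =
  PivotIdentity.pivot-identity R x y M α β a b M-sym a≢b Mab Maa Mbb
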